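{- Let $\epsilon_{1-s}\dotsc\epsilon_{ -1}\star\epsilon_1\dotsc\epsilon_{k-s}$ be a landscape, and let $f\colon\mathbb{F}_2^k\to\mathbb{F}_2$ be its primitive landscape function \[ f(x_1,\dotsc,x_k)=x_s\oplus\prod_{i\,:\,\epsilon_i\in\{0,1\}}(x_{s+i}\oplus\epsilon_i\oplus 1). \] Suppose that for each $d_1$ with $\epsilon_{d_1}\in\{0,1\}$ there exists $d_2$ such that $\epsilon_{d_2}$ and $\epsilon_{d_1+d_2}$ are both defined and $\{\epsilon_{d_2},\epsilon_{d_1+d_2}\}=\{0,1\}$. Then the cellular automaton $F\colon\mathbb{F}_2^{\mathbb{Z}}\to\mathbb{F}_2^{\mathbb{Z}}$, $F(x)_i=f(x_i,\dotsc,x_{i+k-1})$, is invertible, and $f$ is a proper lifting.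
   Context: A landscape is a string of symbols $\epsilon_{1-s}\dotsc\epsilon_{ -1}\star\epsilon_1\dotsc\epsilon_{k-s}$ (with $\star$ occupying position $0$, so $\epsilon_0$ is not one of the symbols $0,1$), where $\epsilon_i\in\{0,1,-\}$ for each $i\neq 0$, and $\epsilon_{1-s}\in\{0,1\}$, $\epsilon_{k-s}\in\{0,1\}$. A Boolean function $f\colon\mathbb{F}_2^k\to\mathbb{F}_2$ induces, for every $n\geq k$, the map $F\colon\mathbb{F}_2^n\to\mathbb{F}_2^n$ with $F(x)_i=f(x_i,\dotsc,x_{i+k-1})$ (indices mod $n$). $f$ has diameter $k$ if it depends on both $x_1$ and $x_k$; it is a $(k,n)$-lifting if it has diameter $k$ and this $F$ is bijective; it is a proper lifting if it is a $(k,n)$-lifting for every $n\geq k$. -}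

module Defs where

open import Data.Bool using (Bool; true; false; not; _xor_; _∧_; if_then_else_)
open import Data.Maybe using (Maybe; just; nothing)
open import Data.Nat as ℕ using (ℕ; zero; suc; NonZero)
open import Data.Nat.DivMod using (_mod_)
open import Data.Fin as Fin using (Fin; toℕ; fromℕ)
open import Data.Fin.Properties using () renaming (_≟_ to _≟ᶠ_)
open import Data.Integer as ℤ using (ℤ; +_; -_)
open import Data.List using (foldr; map)
open import Data.List.Base using ()
open import Data.Fin using ()
open import Data.Product using (Σ; ∃; _×_; _,_)
open import Data.Empty using (⊥)
open import Relation.Binary.PropositionalEquality using (_≡_; _≢_)
open import Relation.Nullary using (yes; no)
import Data.List.Base as L
import Data.Fin.Base as F

-- Conventions
--  * Bits 𝔽₂ are represented by Bool (false = 0, true = 1, ⊕ = xor,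
--    product = ∧).
--  * A Boolean function f : 𝔽₂ᵏ → 𝔽₂ is (Fin k → Bool) → Bool, where the
--    paper's variable x_m (1 ≤ m ≤ k) is x (m - 1) (0-indexed).
--  * A landscape of length k is given by the 0-indexed position
--    `star : Fin k` of ⋆ (the paper's s is toℕ star + 1) and a function
--    ε : ℤ → Maybe Bool giving the symbol ε_i at offset i
--    (just b = the bit b, nothing = '-').  Only offsets i with
--    1-s ≤ i ≤ k-s, i ≠ 0 are meaningful ("defined"); values of ε
--    elsewhere are never used.

-- offset i of the 0-indexed position j, relative to ⋆:  i = (j+1) - s
offset : ∀ {k} → Fin k → Fin k → ℤ
offset star j = + toℕ j ℤ.- + toℕ star

record Landscape (k : ℕ) : Set where
  field
    star : Fin k
    ε    : ℤ → Maybe Bool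

  ValidPos : ℤ → Set
  ValidPos i = (∃ λ (j : Fin k) → offset star j ≡ i) × (i ≢ + 0)

  BitAt : ℤ → Bool → Set
  BitAt i b = ValidPos i × (ε i ≡ just b)

  IsBit : ℤ → Set
  IsBit i = ∃ λ b → BitAt i b

  leftEnd : ℤ
  leftEnd = - (+ toℕ star)

  rightEnd : ℤ
  rightEnd = + (k ℕ.∸ 1) ℤ.- + toℕ star

  field
    leftEnd-bit  : IsBit leftEnd
    rightEnd-bit : IsBit rightEnd

-- primitive landscape function
--   f(x_1..x_k) = x_s ⊕ ∏_{i : ε_i ∈ {0,1}} (x_{s+i} ⊕ ε_i ⊕ 1)
-- (position j ≠ star has offset i = offset star j ≠ 0, and x_{s+i} = x j)
primitiveFun : ∀ {k} → Landscape k → (Fin k → Bool) → Bool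
primitiveFun {k} 𝓛 x =
  x star xor L.foldr _∧_ true (L.map factor (L.allFin k))
  where
  open Landscape 𝓛
  factor : Fin k → Bool
  factor j with j ≟ᶠ star
  ... | yes _ = true
  ... | no _ with ε (offset star j)
  ...   | just b  = (x j xor b) xor true
  ...   | nothing = true

PairCondition : ∀ {k} → Landscape k → Set
PairCondition L =
  ∀ d₁ → IsBit d₁ →
    ∃ λ d₂ → ∃ λ b₁ → ∃ λ b₂ →
      BitAt d₂ b₁ × BitAt (d₁ ℤ.+ d₂) b₂ × b₁ ≢ b₂
  where open Landscape L

globalℤ : ∀ {k} → ((Fin k → Bool) → Bool) → (ℤ → Bool) → (ℤ → Bool)
globalℤ f x i = f (λ j → x (i ℤ.+ + toℕ j))

globalN : ∀ {k} (n : ℕ) .{{_ : NonZero n}} →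
          ((Fin k → Bool) → Bool) → (Fin n → Bool) → (Fin n → Bool)
globalN n f x i = f (λ j → x ((toℕ i ℕ.+ toℕ j) mod n))

-- bijectivity of a map between function spaces, equality taken pointwise
-- (no function extensionality in Agda)
Bijective : ∀ {A B : Set} → ((A → Bool) → (B → Bool)) → Set
Bijective {A} {B} F =
  (∀ (x y : A → Bool) → (∀ i → F x i ≡ F y i) → ∀ a → x a ≡ y a) ×
  (∀ (y : B → Bool) → ∃ λ (x : A → Bool) → ∀ b → F x b ≡ y b)

flipAt : ∀ {k} → Fin k → (Fin k → Bool) → (Fin k → Bool)
flipAt j x i with i ≟ᶠ j
... | yes _ = not (x i)
... | no _  = x i

DependsOn : ∀ {k} → ((Fin k → Bool) → Bool) → Fin k → Set
DependsOn f j = ∃ λ x → f x ≢ f (flipAt j x)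

HasDiameter : ∀ {k} → ((Fin k → Bool) → Bool) → Set
HasDiameter {zero}  f = ⊥
HasDiameter {suc m} f = DependsOn f Fin.zero × DependsOn f (fromℕ m)

IsLifting : ∀ {k} → ((Fin k → Bool) → Bool) → ℕ → Set
IsLifting f n = HasDiameter f × ((nz : NonZero n) → Bijective (globalN n {{nz}} f))

ProperLifting : ∀ {k} → ((Fin k → Bool) → Bool) → Set
ProperLifting {k} f = ∀ n → k ℕ.≤ n → IsLifting f n

-- Write P(c) for "the window of x centred at c agrees with the landscape".
-- F is a shift of the map G(x)_c = x_c ⊕ P(c), so it suffices that G is an
-- involution, i.e. that G does not change P.  If P(c) holds then, by the
-- pair condition, P fails at c + d for every bit position d (the windows at c
-- and c + d would ask for different bits at c + d + d₂); hence G leaves every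
-- cell read by the window at c untouched, and P(c) survives G.  Conversely,
-- if P holds at c after G, then no cell c + d was flipped, since a flip there
-- would need P(c + d) before, and hence after, G.  The argument only uses an
-- action of ℤ on the cells, so it covers ℤ and every cycle ℤ/n at once.
module Submission where

open import Defs
open import Data.Nat using (ℕ)
open import Data.Product using (_×_)

open import Data.Bool using (Bool; true; false; not; _xor_; T)
open import Data.Bool.ListAction using (and; all)
open import Data.Bool.Properties
  using (T-≡; not-injective; not-¬; xor-assoc; xor-same; xor-identityʳ)
open import Data.Empty using (⊥-elim)
open import Data.Fin using (Fin; toℕ; fromℕ)
open import Data.Fin.Properties
  using (¬Fin0; toℕ<n; toℕ-injective; toℕ-fromℕ; toℕ-fromℕ<; _≟_)
open import Data.Integer as ℤ using (ℤ; +_; -[1+_]; -_)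
import Data.Integer.Properties as ℤ
open import Data.Integer.Tactic.RingSolver using (solve-∀)
open import Data.List using (allFin)
open import Data.List.Properties using (map-cong)
open import Data.List.Relation.Unary.All.Properties
  using (all⁺; all⁻; tabulate⁺; tabulate⁻)
open import Data.Maybe using (just; nothing; fromMaybe)
open import Data.Nat as ℕ using (zero; suc; NonZero; _%_)
open import Data.Nat.DivMod
  using (_mod_; %-distribˡ-+; m%n%n≡m%n; [m+n]%n≡m%n; m<n⇒m%n≡m; m%n<n)
import Data.Nat.Properties as ℕ
open import Data.Product using (∃; _,_; proj₁)
open import Function using (_∘_; _⇔_; mk⇔; Equivalence)
open import Relation.Binary.PropositionalEquality
open import Relation.Nullary using (¬_; yes; no)

private
  variable
    A B C I : Set

T-xnor : ∀ {a b} → T ((a xor b) xor true) ⇔ a ≡ b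
T-xnor {false} {false} = mk⇔ (λ _ → refl) _
T-xnor {true}  {true}  = mk⇔ (λ _ → refl) _
T-xnor {false} {true}  = mk⇔ (λ ()) (λ ())
T-xnor {true}  {false} = mk⇔ (λ ()) (λ ())

T-injective : ∀ {a b} → T a ⇔ T b → a ≡ b
T-injective {false} {false} _ = refl
T-injective {true}  {true}  _ = refl
T-injective {false} {true}  a⇔b = ⊥-elim (Equivalence.from a⇔b _)
T-injective {true}  {false} a⇔b = ⊥-elim (Equivalence.to a⇔b _)

¬T⇒≡false : ∀ {a} → ¬ T a → a ≡ false
¬T⇒≡false {false} _  = refl
¬T⇒≡false {true}  ¬t = ⊥-elim (¬t _)

xor-cancelˡ : ∀ a {p q} → a xor p ≡ a xor q → p ≡ q
xor-cancelˡ false eq = eq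
xor-cancelˡ true  eq = not-injective eq

xor-involutiveʳ : ∀ a p → (a xor p) xor p ≡ a
xor-involutiveʳ a p = begin
  (a xor p) xor p ≡⟨ xor-assoc a p p ⟩
  a xor (p xor p) ≡⟨ cong (a xor_) (xor-same p) ⟩
  a xor false     ≡⟨ xor-identityʳ a ⟩
  a               ∎
  where open ≡-Reasoning

Congruent≗ : ((A → Bool) → (B → Bool)) → Set
Congruent≗ F = ∀ {x y} → x ≗ y → F x ≗ F y

Bijective-≗ : {F G : (A → Bool) → (B → Bool)} →
              (∀ x → F x ≗ G x) → Bijective G → Bijective F
Bijective-≗ F≗G (inj , surj) =
  (λ x y Fx≗Fy → inj x y (λ b → trans (sym (F≗G x b)) (trans (Fx≗Fy b) (F≗G y b)))) ,
  (λ z → let x , Gx≗z = surj z in x , λ b → trans (F≗G x b) (Gx≗z b))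

∘-bijective : {F : (B → Bool) → (C → Bool)} {G : (A → Bool) → (B → Bool)} →
              Congruent≗ F → Bijective F → Bijective G → Bijective (F ∘ G)
∘-bijective {F = F} {G} F-cong (injF , surjF) (injG , surjG) =
  (λ x y FGx≗FGy → injG x y (injF (G x) (G y) FGx≗FGy)) ,
  (λ z → let y , Fy≗z = surjF z ; x , Gx≗y = surjG y
         in x , λ c → trans (F-cong Gx≗y c) (Fy≗z c))

involution⇒bijective : {G : (A → Bool) → (A → Bool)} →
                       Congruent≗ G → (∀ x → G (G x) ≗ x) → Bijective G
involution⇒bijective {G = G} G-cong G∘G≗id =
  (λ x y Gx≗Gy a → trans (sym (G∘G≗id x a)) (trans (G-cong Gx≗Gy a) (G∘G≗id y a))) ,
  (λ y → G y , G∘G≗id y)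

reindex-bijective : (φ : B → A) (ψ : A → B) →
                    (∀ a → φ (ψ a) ≡ a) → (∀ b → ψ (φ b) ≡ b) →
                    Bijective (λ (x : A → Bool) → x ∘ φ)
reindex-bijective φ ψ φ∘ψ≗id ψ∘φ≗id =
  (λ x y x∘φ≗y∘φ a → subst (λ c → x c ≡ y c) (φ∘ψ≗id a) (x∘φ≗y∘φ (ψ a))) ,
  (λ y → y ∘ ψ , λ b → cong y (ψ∘φ≗id b))

record ℤAction (I : Set) : Set where
  infixl 6 _▷_
  field
    _▷_        : I → ℤ → I
    ▷-identity : ∀ c → c ▷ + 0 ≡ c
    ▷-assoc    : ∀ c a b → (c ▷ a) ▷ b ≡ c ▷ (a ℤ.+ b)

  ▷-cancelʳ : ∀ c a → (c ▷ a) ▷ (- a) ≡ c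
  ▷-cancelʳ c a =
    trans (▷-assoc c a (- a)) (trans (cong (c ▷_) (ℤ.+-inverseʳ a)) (▷-identity c))

  ▷-cancelˡ : ∀ c a → (c ▷ (- a)) ▷ a ≡ c
  ▷-cancelˡ c a =
    trans (▷-assoc c (- a) a) (trans (cong (c ▷_) (ℤ.+-inverseˡ a)) (▷-identity c))

  cellular : ∀ {k} → ((Fin k → Bool) → Bool) → (I → Bool) → (I → Bool)
  cellular f x i = f (λ j → x (i ▷ + toℕ j))

translationAction : ℤAction ℤ
translationAction = record
  { _▷_ = ℤ._+_ ; ▷-identity = ℤ.+-identityʳ ; ▷-assoc = ℤ.+-assoc }

module PermutationPowers (σ σ⁻¹ : I → I)
                         (σ⁻¹∘σ : ∀ c → σ⁻¹ (σ c) ≡ c)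
                         (σ∘σ⁻¹ : ∀ c → σ (σ⁻¹ c) ≡ c) where

  infixl 6 _^_
  _^_ : I → ℤ → I
  c ^ + zero       = c
  c ^ + suc m      = σ c ^ + m
  c ^ -[1+ zero ]  = σ⁻¹ c
  c ^ -[1+ suc m ] = σ⁻¹ c ^ -[1+ m ]

  ^-suc : ∀ c a → c ^ (+ 1 ℤ.+ a) ≡ σ c ^ a
  ^-suc c (+ m)        = refl
  ^-suc c -[1+ zero ]  = sym (σ⁻¹∘σ c)
  ^-suc c -[1+ suc m ] = cong (_^ -[1+ m ]) (sym (σ⁻¹∘σ c))

  ^-pred : ∀ c a → c ^ (-[1+ 0 ] ℤ.+ a) ≡ σ⁻¹ c ^ a
  ^-pred c (+ zero)  = refl
  ^-pred c (+ suc m) = cong (_^ + m) (sym (σ∘σ⁻¹ c))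
  ^-pred c -[1+ m ]  = refl

  ^-assoc : ∀ c a b → (c ^ a) ^ b ≡ c ^ (a ℤ.+ b)
  ^-assoc c (+ zero) b = cong (c ^_) (sym (ℤ.+-identityˡ b))
  ^-assoc c (+ suc m) b = begin
    (σ c ^ + m) ^ b           ≡⟨ ^-assoc (σ c) (+ m) b ⟩
    σ c ^ (+ m ℤ.+ b)         ≡⟨ ^-suc c (+ m ℤ.+ b) ⟨
    c ^ (+ 1 ℤ.+ (+ m ℤ.+ b)) ≡⟨ cong (c ^_) (ℤ.+-assoc (+ 1) (+ m) b) ⟨
    c ^ (+ suc m ℤ.+ b)       ∎
    where open ≡-Reasoning
  ^-assoc c -[1+ zero ] b = sym (^-pred c b)
  ^-assoc c -[1+ suc m ] b = begin
    (σ⁻¹ c ^ -[1+ m ]) ^ b              ≡⟨ ^-assoc (σ⁻¹ c) -[1+ m ] b ⟩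
    σ⁻¹ c ^ (-[1+ m ] ℤ.+ b)            ≡⟨ ^-pred c (-[1+ m ] ℤ.+ b) ⟨
    c ^ (-[1+ 0 ] ℤ.+ (-[1+ m ] ℤ.+ b)) ≡⟨ cong (c ^_) (ℤ.+-assoc -[1+ 0 ] -[1+ m ] b) ⟨
    c ^ (-[1+ suc m ] ℤ.+ b)            ∎
    where open ≡-Reasoning

  powerAction : ℤAction I
  powerAction = record { _▷_ = _^_ ; ▷-identity = λ _ → refl ; ▷-assoc = ^-assoc }

[m%n+k]%n≡[m+k]%n : ∀ m k n .{{_ : NonZero n}} → (m % n ℕ.+ k) % n ≡ (m ℕ.+ k) % n
[m%n+k]%n≡[m+k]%n m k n = begin
  (m % n ℕ.+ k) % n         ≡⟨ %-distribˡ-+ (m % n) k n ⟩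
  (m % n % n ℕ.+ k % n) % n ≡⟨ cong (λ r → (r ℕ.+ k % n) % n) (m%n%n≡m%n m n) ⟩
  (m % n ℕ.+ k % n) % n     ≡⟨ %-distribˡ-+ m k n ⟨
  (m ℕ.+ k) % n             ∎
  where open ≡-Reasoning

module Cycle (n′ : ℕ) where

  n : ℕ
  n = suc n′

  rotate : ℕ → Fin n → Fin n
  rotate m c = (toℕ c ℕ.+ m) mod n

  toℕ-rotate : ∀ m c → toℕ (rotate m c) ≡ (toℕ c ℕ.+ m) % n
  toℕ-rotate m c = toℕ-fromℕ< (m%n<n (toℕ c ℕ.+ m) n)

  toℕ%n≡toℕ : ∀ (c : Fin n) → toℕ c % n ≡ toℕ c
  toℕ%n≡toℕ c = m<n⇒m%n≡m (toℕ<n c)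

  rotate-zero : ∀ c → rotate 0 c ≡ c
  rotate-zero c = toℕ-injective (begin
    toℕ (rotate 0 c)  ≡⟨ toℕ-rotate 0 c ⟩
    (toℕ c ℕ.+ 0) % n ≡⟨ cong (_% n) (ℕ.+-identityʳ (toℕ c)) ⟩
    toℕ c % n         ≡⟨ toℕ%n≡toℕ c ⟩
    toℕ c             ∎)
    where open ≡-Reasoning

  rotate-period : ∀ c → rotate n c ≡ c
  rotate-period c = toℕ-injective (begin
    toℕ (rotate n c)  ≡⟨ toℕ-rotate n c ⟩
    (toℕ c ℕ.+ n) % n ≡⟨ [m+n]%n≡m%n (toℕ c) n ⟩
    toℕ c % n         ≡⟨ toℕ%n≡toℕ c ⟩
    toℕ c             ∎)
    where open ≡-Reasoning

  rotate-+ : ∀ a b c → rotate a (rotate b c) ≡ rotate (b ℕ.+ a) c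
  rotate-+ a b c = toℕ-injective (begin
    toℕ (rotate a (rotate b c))       ≡⟨ toℕ-rotate a (rotate b c) ⟩
    (toℕ (rotate b c) ℕ.+ a) % n      ≡⟨ cong (λ r → (r ℕ.+ a) % n) (toℕ-rotate b c) ⟩
    ((toℕ c ℕ.+ b) % n ℕ.+ a) % n     ≡⟨ [m%n+k]%n≡[m+k]%n (toℕ c ℕ.+ b) a n ⟩
    (toℕ c ℕ.+ b ℕ.+ a) % n           ≡⟨ cong (_% n) (ℕ.+-assoc (toℕ c) b a) ⟩
    (toℕ c ℕ.+ (b ℕ.+ a)) % n         ≡⟨ toℕ-rotate (b ℕ.+ a) c ⟨
    toℕ (rotate (b ℕ.+ a) c)          ∎)
    where open ≡-Reasoning

  rotate-inverseˡ : ∀ c → rotate n′ (rotate 1 c) ≡ c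
  rotate-inverseˡ c = trans (rotate-+ n′ 1 c) (rotate-period c)

  rotate-inverseʳ : ∀ c → rotate 1 (rotate n′ c) ≡ c
  rotate-inverseʳ c =
    trans (rotate-+ 1 n′ c) (trans (cong (λ m → rotate m c) (ℕ.+-comm n′ 1)) (rotate-period c))

  open PermutationPowers (rotate 1) (rotate n′) rotate-inverseˡ rotate-inverseʳ public

  cycleAction : ℤAction (Fin n)
  cycleAction = powerAction

  ^-rotate : ∀ c m → c ^ + m ≡ rotate m c
  ^-rotate c zero    = sym (rotate-zero c)
  ^-rotate c (suc m) = trans (^-rotate (rotate 1 c) m) (rotate-+ m 1 c)

module Window {k} (L : Landscape k) where
  open Landscape L

  offset-self : offset star star ≡ + 0
  offset-self = ℤ.+-inverseʳ (+ toℕ star)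

  offset≢0 : ∀ {j} → j ≢ star → offset star j ≢ + 0
  offset≢0 j≢star eq = j≢star (toℕ-injective (ℤ.+-injective (ℤ.i-j≡0⇒i≡j _ _ eq)))

  agreesAt : (Fin k → Bool) → Fin k → Bool
  agreesAt w j with j ≟ star
  ... | yes _ = true
  ... | no _ with ε (offset star j)
  ...   | just b  = (w j xor b) xor true
  ...   | nothing = true

  windowMatches : (Fin k → Bool) → Bool
  windowMatches w = all (agreesAt w) (allFin k)

  -- The factor of primitiveFun is local to its where block; the first
  -- component of this pair gives it a name.
  private
    primitiveFactor : ∀ w → ∃ λ g → primitiveFun L w ≡ w star xor all g (allFin k)
    primitiveFactor w = _ , refl

    primitiveFactor≗agreesAt : ∀ w → proj₁ (primitiveFactor w) ≗ agreesAt w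
    primitiveFactor≗agreesAt w j with j ≟ star
    ... | yes _ = refl
    ... | no _ with ε (offset star j)
    ...   | just _  = refl
    ...   | nothing = refl

  primitiveFun-xor : ∀ w → primitiveFun L w ≡ w star xor windowMatches w
  primitiveFun-xor w =
    cong (λ bs → w star xor and bs) (map-cong (primitiveFactor≗agreesAt w) (allFin k))

  agreesAt-cong : ∀ {w w′} → w ≗ w′ → agreesAt w ≗ agreesAt w′
  agreesAt-cong w≗w′ j with j ≟ star
  ... | yes _ = refl
  ... | no _ with ε (offset star j)
  ...   | just b  = cong (λ v → (v xor b) xor true) (w≗w′ j)
  ...   | nothing = refl

  windowMatches-cong : ∀ {w w′} → w ≗ w′ → windowMatches w ≡ windowMatches w′
  windowMatches-cong w≗w′ = cong and (map-cong (agreesAt-cong w≗w′) (allFin k))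

  primitiveFun-cong : ∀ {w w′} → w ≗ w′ → primitiveFun L w ≡ primitiveFun L w′
  primitiveFun-cong {w} {w′} w≗w′ = begin
    primitiveFun L w             ≡⟨ primitiveFun-xor w ⟩
    w star xor windowMatches w   ≡⟨ cong₂ _xor_ (w≗w′ star) (windowMatches-cong w≗w′) ⟩
    w′ star xor windowMatches w′ ≡⟨ primitiveFun-xor w′ ⟨
    primitiveFun L w′            ∎
    where open ≡-Reasoning

  Matches : (Fin k → Bool) → Set
  Matches w = ∀ j b → BitAt (offset star j) b → w j ≡ b

  agreesAt-sound : ∀ {w j b} → T (agreesAt w j) → BitAt (offset star j) b → w j ≡ b
  agreesAt-sound {w} {j} t ((_ , offset≢0′) , εj) with j ≟ star
  ... | yes refl = ⊥-elim (offset≢0′ offset-self)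
  ... | no _ rewrite εj = Equivalence.to T-xnor t

  agreesAt-complete : ∀ {w} → Matches w → ∀ j → T (agreesAt w j)
  agreesAt-complete {w} m j with j ≟ star
  ... | yes _ = _
  ... | no j≢star with ε (offset star j) in εj
  ...   | just b  = Equivalence.from T-xnor (m j b (((j , refl) , offset≢0 j≢star) , εj))
  ...   | nothing = _

  windowMatches⇔Matches : ∀ {w} → T (windowMatches w) ⇔ Matches w
  windowMatches⇔Matches {w} = mk⇔
    (λ t j b → agreesAt-sound (tabulate⁻ (all⁺ (agreesAt w) (allFin k) t) j))
    (λ m → all⁻ (agreesAt w) (tabulate⁺ (agreesAt-complete m)))

  landscapeWord : Fin k → Bool
  landscapeWord j = fromMaybe false (ε (offset star j))

  landscapeWord-matches : Matches landscapeWord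
  landscapeWord-matches j b (_ , εj) = cong (fromMaybe false) εj

  bit⇒dependsOn : ∀ j → IsBit (offset star j) → DependsOn (primitiveFun L) j
  bit⇒dependsOn j (b , bit@((_ , offset≢0′) , _)) = landscapeWord , flip-changes-value
    where
    flipped : Fin k → Bool
    flipped = flipAt j landscapeWord

    flipped-star : flipped star ≡ landscapeWord star
    flipped-star with star ≟ j
    ... | yes refl = ⊥-elim (offset≢0′ offset-self)
    ... | no _     = refl

    flipped-j : flipped j ≡ not b
    flipped-j with j ≟ j
    ... | yes _  = cong not (landscapeWord-matches j b bit)
    ... | no j≢j = ⊥-elim (j≢j refl)

    flip-changes-value : primitiveFun L landscapeWord ≢ primitiveFun L flipped
    flip-changes-value eq = not-¬ flipped-matches-at-j flipped-j
      where
      windowMatches-landscapeWord : windowMatches landscapeWord ≡ true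
      windowMatches-landscapeWord =
        Equivalence.to T-≡ (Equivalence.from windowMatches⇔Matches landscapeWord-matches)

      windowMatches-flipped : windowMatches flipped ≡ true
      windowMatches-flipped = sym (xor-cancelˡ (landscapeWord star) (begin
        landscapeWord star xor true
          ≡⟨ cong (landscapeWord star xor_) windowMatches-landscapeWord ⟨
        landscapeWord star xor windowMatches landscapeWord
          ≡⟨ primitiveFun-xor landscapeWord ⟨
        primitiveFun L landscapeWord
          ≡⟨ eq ⟩
        primitiveFun L flipped
          ≡⟨ primitiveFun-xor flipped ⟩
        flipped star xor windowMatches flipped
          ≡⟨ cong (_xor windowMatches flipped) flipped-star ⟩
        landscapeWord star xor windowMatches flipped
          ∎))
        where open ≡-Reasoning

      flipped-matches-at-j : flipped j ≡ b
      flipped-matches-at-j =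
        Equivalence.to windowMatches⇔Matches (Equivalence.from T-≡ windowMatches-flipped) j b bit

primitiveFun-hasDiameter : ∀ {k} (L : Landscape k) → HasDiameter (primitiveFun L)
primitiveFun-hasDiameter {zero}  L = ¬Fin0 (Landscape.star L)
primitiveFun-hasDiameter {suc m} L =
  bit⇒dependsOn Fin.zero (subst IsBit (sym (ℤ.+-identityˡ _)) leftEnd-bit) ,
  bit⇒dependsOn (fromℕ m)
    (subst IsBit (cong (λ r → + r ℤ.- + toℕ star) (sym (toℕ-fromℕ m))) rightEnd-bit)
  where
  open Landscape L
  open Window L

module Toggle (A : ℤAction I) {k} (L : Landscape k) (pc : PairCondition L) where
  open ℤAction A
  open Landscape L
  open Window L

  window : (I → Bool) → I → Fin k → Bool
  window x c j = x (c ▷ offset star j)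

  matchAt : (I → Bool) → I → Bool
  matchAt x c = windowMatches (window x c)

  MatchesAt : (I → Bool) → I → Set
  MatchesAt x c = ∀ d b → BitAt d b → x (c ▷ d) ≡ b

  matchAt⇔MatchesAt : ∀ x c → T (matchAt x c) ⇔ MatchesAt x c
  matchAt⇔MatchesAt x c = mk⇔
    (λ t → λ { d b bit@(((j , refl) , _) , _) → Equivalence.to windowMatches⇔Matches t j b bit })
    (λ m → Equivalence.from windowMatches⇔Matches (λ j b → m (offset star j) b))

  matchesAt-exclusive : ∀ x c {d} → IsBit d → MatchesAt x c → ¬ MatchesAt x (c ▷ d)
  matchesAt-exclusive x c {d} d-bit m m′ =
    let d₂ , b₁ , b₂ , d₂-bit , d+d₂-bit , b₁≢b₂ = pc d d-bit
    in b₁≢b₂ (begin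
      b₁                 ≡⟨ m′ d₂ b₁ d₂-bit ⟨
      x (c ▷ d ▷ d₂)     ≡⟨ cong x (▷-assoc c d d₂) ⟩
      x (c ▷ (d ℤ.+ d₂)) ≡⟨ m (d ℤ.+ d₂) b₂ d+d₂-bit ⟩
      b₂                 ∎)
    where open ≡-Reasoning

  toggle : (I → Bool) → (I → Bool)
  toggle x c = x c xor matchAt x c

  toggle-unmatched : ∀ x c → ¬ MatchesAt x c → toggle x c ≡ x c
  toggle-unmatched x c ¬m = trans
    (cong (x c xor_) (¬T⇒≡false (¬m ∘ Equivalence.to (matchAt⇔MatchesAt x c))))
    (xor-identityʳ (x c))

  toggle-preserves-match : ∀ x c → MatchesAt x c → MatchesAt (toggle x) c
  toggle-preserves-match x c m d b bit =
    trans (toggle-unmatched x (c ▷ d) (matchesAt-exclusive x c (b , bit) m)) (m d b bit)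

  toggle-reflects-match : ∀ x c → MatchesAt (toggle x) c → MatchesAt x c
  toggle-reflects-match x c m d b bit = trans
    (sym (toggle-unmatched x (c ▷ d)
      (matchesAt-exclusive (toggle x) c (b , bit) m ∘ toggle-preserves-match x (c ▷ d))))
    (m d b bit)

  matchAt-toggle : ∀ x c → matchAt (toggle x) c ≡ matchAt x c
  matchAt-toggle x c = T-injective (mk⇔
    (from (matchAt⇔MatchesAt x c) ∘ toggle-reflects-match x c ∘ to (matchAt⇔MatchesAt x′ c))
    (from (matchAt⇔MatchesAt x′ c) ∘ toggle-preserves-match x c ∘ to (matchAt⇔MatchesAt x c)))
    where
    open Equivalence
    x′ : I → Bool
    x′ = toggle x

  toggle-involutive : ∀ x → toggle (toggle x) ≗ x
  toggle-involutive x c = begin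
    toggle x c xor matchAt (toggle x) c  ≡⟨ cong (toggle x c xor_) (matchAt-toggle x c) ⟩
    (x c xor matchAt x c) xor matchAt x c ≡⟨ xor-involutiveʳ (x c) (matchAt x c) ⟩
    x c                                   ∎
    where open ≡-Reasoning

  toggle-cong : Congruent≗ toggle
  toggle-cong x≗y c = cong₂ _xor_ (x≗y c) (windowMatches-cong (x≗y ∘ (c ▷_) ∘ offset star))

  shift unshift : I → I
  shift i   = i ▷ + toℕ star
  unshift i = i ▷ - + toℕ star

  window-shift : ∀ i j → shift i ▷ offset star j ≡ i ▷ + toℕ j
  window-shift i j = trans (▷-assoc i _ _) (cong (i ▷_) (s+[j-s]≡j (+ toℕ star) (+ toℕ j)))
    where
    s+[j-s]≡j : ∀ s j → s ℤ.+ (j ℤ.- s) ≡ j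
    s+[j-s]≡j = solve-∀

  cellular≗toggle∘shift : ∀ x → cellular (primitiveFun L) x ≗ toggle x ∘ shift
  cellular≗toggle∘shift x i = begin
    primitiveFun L (λ j → x (i ▷ + toℕ j))
      ≡⟨ primitiveFun-xor (λ j → x (i ▷ + toℕ j)) ⟩
    x (shift i) xor windowMatches (λ j → x (i ▷ + toℕ j))
      ≡⟨ cong (x (shift i) xor_) (windowMatches-cong (cong x ∘ window-shift i)) ⟨
    toggle x (shift i)
      ∎
    where open ≡-Reasoning

  cellular-bijective : Bijective (cellular (primitiveFun L))
  cellular-bijective = Bijective-≗ cellular≗toggle∘shift
    (∘-bijective (_∘ shift)
      (reindex-bijective shift unshift (λ i → ▷-cancelˡ i _) (λ i → ▷-cancelʳ i _))
      (involution⇒bijective toggle-cong toggle-involutive))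

primitiveFun-properLifting : ∀ {k} (L : Landscape k) → PairCondition L →
                             ProperLifting (primitiveFun L)
primitiveFun-properLifting L pc n _ = primitiveFun-hasDiameter L , cycle-bijective n
  where
  cycle-bijective : ∀ n (nz : NonZero n) → Bijective (globalN n {{nz}} (primitiveFun L))
  cycle-bijective (suc n′) _ = Bijective-≗
    (λ x i → Window.primitiveFun-cong L (λ j → cong x (sym (^-rotate i (toℕ j)))))
    (Toggle.cellular-bijective cycleAction L pc)
    where open Cycle n′

mainTheorem3 : ∀ {k : ℕ} (L : Landscape k) → PairCondition L →
    Bijective (globalℤ (primitiveFun L)) × ProperLifting (primitiveFun L)
mainTheorem3 L pc =
  Toggle.cellular-bijective translationAction L pc , primitiveFun-properLifting L pc
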